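{- Let $n\ge1$, $k=6n$, let $M$ be an $n\times n$ Boolean matrix and $u,v\in\{0,1\}^n$. Let $G$ be the undirected graph constructed as follows. For each $1\le i,j\le n$ there is a bit graph $B_{i,j}$ on $k$ vertices, two of which are designated special vertex 1 and special vertex 2; if $M_{i,j}=1$, $B_{i,j}$ contains a path with $k-1$ edges through all its vertices from special vertex 1 to special vertex 2, and if $M_{i,j}=0$, $B_{i,j}$ has no internal edges. For each row $i$ there is a row graph $R_i$ on $3$ vertices, one of them special, and the special vertex of $R_i$ is joined to special vertex 1 of $B_{i,j}$ for every $1\le j\le n$; if $u_i=1$ then $R_i$ additionally contains all three edges among its vertices (a triangle), otherwise it has no internal edges. For each column $j$ there is a column graph $C_j$ on $3$ vertices, one of them special, whose special vertex is joined to special vertex 2 of $B_{i,j}$ for every $1\le i\le n$; if $v_j=1$ then $C_j$ is a triangle, otherwise it has no internal edges. Then there exists a nonempty subset $S$ of vertices of $G$ with density $\rho(S)\ge\frac{k+7}{k+6}$ if and only if $u^\top Mv=1$.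
   Context: For an undirected graph $G=(V,E)$ and nonempty $S\subseteq V$, $E(S)$ is the set of edges with both endpoints in $S$ and the density is $\rho(S)=|E(S)|/|S|$. $u^\top Mv$ is computed in Boolean arithmetic, i.e. it equals $1$ iff there exist $i,j$ with $u_i=M_{i,j}=v_j=1$. -}

module Defs where

open import Data.Nat using (ℕ; zero; suc; _+_; _*_)
open import Data.Bool using (Bool; true; false; _∧_; if_then_else_)
open import Data.Fin using (Fin; zero; suc; fromℕ)
open import Data.List using (List; []; _∷_; _++_; map; concatMap; allFin)
open import Data.Bool.ListAction using (any)
open import Data.Product using (_×_; _,_; proj₁; proj₂)

bilin : (n : ℕ) → (Fin n → Bool) → (Fin n → Fin n → Bool) → (Fin n → Bool) → Bool
bilin n u M v = any (λ i → any (λ j → u i ∧ M i j ∧ v j) (allFin n)) (allFin n)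

-- Vertices of G, for n×n matrices and bit graphs on k vertices.
--   bit i j t : vertex t of the bit graph B_{i,j}
--   row i a   : vertex a of the row graph R_i    (a = zero is the special vertex)
--   col j a   : vertex a of the column graph C_j (a = zero is the special vertex)
data Vtx (n k : ℕ) : Set where
  bit : Fin n → Fin n → Fin k → Vtx n k
  row : Fin n → Fin 3 → Vtx n k
  col : Fin n → Fin 3 → Vtx n k

allVtx : (n k : ℕ) → List (Vtx n k)
allVtx n k =
  concatMap (λ i → concatMap (λ j → map (bit i j) (allFin k)) (allFin n)) (allFin n)
  ++ concatMap (λ i → map (row i) (allFin 3)) (allFin n)
  ++ concatMap (λ j → map (col j) (allFin 3)) (allFin n)

-- Hamiltonian path on Fin (suc K): 0 - 1 - ... - K  (K edges),
-- from special vertex 1 (= zero) to special vertex 2 (= fromℕ K).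
pathEdges : (K : ℕ) → List (Fin (suc K) × Fin (suc K))
pathEdges zero = []
pathEdges (suc K) = (zero , suc zero) ∷ map (λ e → suc (proj₁ e) , suc (proj₂ e)) (pathEdges K)

triangle : List (Fin 3 × Fin 3)
triangle = (zero , suc zero) ∷ (zero , suc (suc zero)) ∷ (suc zero , suc (suc zero)) ∷ []

mapE : {A B : Set} → (A → B) → List (A × A) → List (B × B)
mapE f = map (λ e → f (proj₁ e) , f (proj₂ e))

-- Edge list of G, with bit graphs on k = suc K vertices (each undirected edge listed once).
edges : (n K : ℕ) → (Fin n → Fin n → Bool) → (Fin n → Bool) → (Fin n → Bool)
      → List (Vtx n (suc K) × Vtx n (suc K))
edges n K M u v =
  concatMap (λ i → concatMap (λ j →
     if M i j then mapE (bit i j) (pathEdges K) else []) (allFin n)) (allFin n)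
  ++ concatMap (λ i → if u i then mapE (row i) triangle else []) (allFin n)
  ++ concatMap (λ j → if v j then mapE (col j) triangle else []) (allFin n)
  ++ concatMap (λ i → map (λ j → row i zero , bit i j zero) (allFin n)) (allFin n)
  ++ concatMap (λ i → map (λ j → col j zero , bit i j (fromℕ K)) (allFin n)) (allFin n)

count : {A : Set} → (A → Bool) → List A → ℕ
count p [] = 0
count p (x ∷ xs) = if p x then suc (count p xs) else count p xs

card : (n K : ℕ) → (Vtx n (suc K) → Bool) → ℕ
card n K S = count S (allVtx n (suc K))

edgesIn : (n K : ℕ) → (Fin n → Fin n → Bool) → (Fin n → Bool) → (Fin n → Bool)
        → (Vtx n (suc K) → Bool) → ℕ
edgesIn n K M u v S = count (λ e → S (proj₁ e) ∧ S (proj₂ e)) (edges n K M u v)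

-- If u_i = M_ij = v_j = 1, then B_ij ∪ R_i ∪ C_j has k + 6 vertices and (k − 1) + 3 + 3 + 2 = k + 7
-- edges. Conversely, let c = k + 6 and charge every edge of G[S] to a gadget: B_ij owns its path
-- and its two connectors, R_i and C_j own their triangles. A gadget owning e edges and meeting S in s
-- vertices has e ≤ s, so c e ≤ (c + 1) s − s, with one exception: B_ij inside S together with the
-- special vertices of R_i and C_j, where c e = (c + 1) s + 6. If u^T M v = 0, such a block has
-- u_i = 0 or v_j = 0, so its row or column graph has a special vertex in S but no edges, which frees
-- c ≥ 6n: enough for all n blocks of that row or column. Summing, c |E(S)| < (c + 1) |S| for S ≠ ∅.

module Submission where

open import Defs
open import Data.Nat using (ℕ; zero; suc; _+_; _*_; _≤_; _<_; z≤n; s≤s; s≤s⁻¹)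
open import Data.Nat.Properties hiding (_≟_)
open import Algebra.Properties.Semiring.Sum +-*-semiring
  using (sum; sum-syntax; sum-cong-≗; sum-replicate-zero; ∑-distrib-+; *-distribˡ-sum)
open import Data.Nat.Tactic.RingSolver using (solve-∀)
open import Data.Bool using (Bool; true; false; _∧_; not; if_then_else_; T)
open import Data.Bool.Properties using (T-≡)
open import Data.Fin using (Fin; zero; suc; fromℕ)
open import Data.Fin.Properties using (_≟_)
open import Data.List using (List; []; _∷_; _++_; map; concatMap; allFin; tabulate)
open import Data.Product using (Σ; _×_; _,_; proj₁; proj₂; ∃₂)
open import Function using (_∘_)
open import Data.List.Relation.Unary.Any using (satisfied)
open import Data.List.Relation.Unary.Any.Properties using (any⁺; any⁻)
open import Data.List.Membership.Propositional using (lose)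
open import Data.List.Membership.Propositional.Properties using (∈-allFin)
open import Function.Bundles using (_⇔_; mk⇔; Equivalence)
open import Relation.Binary.PropositionalEquality
open import Relation.Nullary.Decidable using (dec-true; decidable-stable; T?)
open import Relation.Nullary using (¬_; does)
open import Data.Empty using (⊥-elim)

⟦_⟧ : Bool → ℕ
⟦ true ⟧ = 1
⟦ false ⟧ = 0

⟦⟧≤1 : ∀ b → ⟦ b ⟧ ≤ 1
⟦⟧≤1 true = ≤-refl
⟦⟧≤1 false = z≤n

⟦∧⟧≤⟦⟧ : ∀ a b → ⟦ a ∧ b ⟧ ≤ ⟦ b ⟧
⟦∧⟧≤⟦⟧ true b = ≤-refl
⟦∧⟧≤⟦⟧ false b = z≤n

size : ∀ {m} → (Fin m → Bool) → ℕ
size f = ∑[ t < _ ] ⟦ f t ⟧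

module _ {A : Set} (p : A → Bool) where

  count-++ : ∀ xs ys → count p (xs ++ ys) ≡ count p xs + count p ys
  count-++ [] ys = refl
  count-++ (x ∷ xs) ys with p x
  ... | true = cong suc (count-++ xs ys)
  ... | false = count-++ xs ys

  count-map : ∀ {B : Set} (f : B → A) xs → count p (map f xs) ≡ count (p ∘ f) xs
  count-map f [] = refl
  count-map f (x ∷ xs) with p (f x)
  ... | true = cong suc (count-map f xs)
  ... | false = count-map f xs

  count-tabulate : ∀ {n} (g : Fin n → A) → count p (tabulate g) ≡ ∑[ i < n ] ⟦ p (g i) ⟧
  count-tabulate {zero} g = refl
  count-tabulate {suc n} g with p (g zero)
  ... | true = cong suc (count-tabulate (g ∘ suc))
  ... | false = count-tabulate (g ∘ suc)

  count-concatMap-tabulate : ∀ {B : Set} {n} (f : B → List A) (g : Fin n → B) →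
    count p (concatMap f (tabulate g)) ≡ ∑[ i < n ] count p (f (g i))
  count-concatMap-tabulate {n = zero} f g = refl
  count-concatMap-tabulate {n = suc n} f g =
    trans (count-++ (f (g zero)) _) (cong (count p (f (g zero)) +_) (count-concatMap-tabulate f (g ∘ suc)))

  count-if : ∀ b xs → count p (if b then xs else []) ≡ (if b then count p xs else 0)
  count-if true xs = refl
  count-if false xs = refl

count-map-allFin : ∀ {A : Set} {m} (p : A → Bool) (g : Fin m → A) → count p (map g (allFin m)) ≡ size (p ∘ g)
count-map-allFin {m = m} p g = trans (count-map p g (allFin m)) (count-tabulate (p ∘ g) (λ t → t))

sum-mono-≤ : ∀ {n} {f g : Fin n → ℕ} → (∀ i → f i ≤ g i) → sum f ≤ sum g
sum-mono-≤ {zero} f≤g = z≤n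
sum-mono-≤ {suc n} f≤g = +-mono-≤ (f≤g zero) (sum-mono-≤ (f≤g ∘ suc))

entry≤sum : ∀ {n} (f : Fin n → ℕ) i → f i ≤ sum f
entry≤sum f zero = m≤m+n (f zero) _
entry≤sum f (suc i) = ≤-trans (entry≤sum (f ∘ suc) i) (m≤n+m _ (f zero))

entry≤∑∑ : ∀ {m n} (f : Fin m → Fin n → ℕ) i j → f i j ≤ ∑[ x < m ] ∑[ y < n ] f x y
entry≤∑∑ {n = n} f i j = ≤-trans (entry≤sum (f i) j) (entry≤sum (λ x → ∑[ y < n ] f x y) i)

sum-const : ∀ n c → ∑[ i < n ] c ≡ n * c
sum-const zero c = refl
sum-const (suc n) c = cong (c +_) (sum-const n c)

sum-δ : ∀ {n} (i : Fin n) c → ∑[ x < n ] (if does (x ≟ i) then c else 0) ≡ c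
sum-δ {suc n} zero c = trans (cong (c +_) (sum-replicate-zero n)) (+-identityʳ c)
sum-δ {suc n} (suc i) c = sum-δ i c

∑∑-separable : ∀ {m n} (f : Fin m → ℕ) (g : Fin n → ℕ) →
  ∑[ i < m ] ∑[ j < n ] (f i + g j) ≡ n * sum f + m * sum g
∑∑-separable {m} {n} f g = begin
  ∑[ i < m ] ∑[ j < n ] (f i + g j)
    ≡⟨ sum-cong-≗ (λ i → trans (∑-distrib-+ (λ _ → f i) g) (cong (_+ sum g) (sum-const n (f i)))) ⟩
  ∑[ i < m ] (n * f i + sum g)        ≡⟨ ∑-distrib-+ (λ i → n * f i) (λ _ → sum g) ⟩
  ∑[ i < m ] (n * f i) + ∑[ i < m ] sum g ≡⟨ cong₂ _+_ (sym (*-distribˡ-sum n f)) (sum-const m (sum g)) ⟩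
  n * sum f + m * sum g               ∎
  where open ≡-Reasoning

∑∑-distrib-+ : ∀ {m n} (f g : Fin m → Fin n → ℕ) →
  ∑[ i < m ] ∑[ j < n ] (f i j + g i j) ≡ ∑[ i < m ] ∑[ j < n ] f i j + ∑[ i < m ] ∑[ j < n ] g i j
∑∑-distrib-+ {n = n} f g =
  trans (sum-cong-≗ (λ i → ∑-distrib-+ (f i) (g i))) (∑-distrib-+ (λ i → ∑[ j < n ] f i j) (λ i → ∑[ j < n ] g i j))

*-distribˡ-∑∑ : ∀ {m n} c (f : Fin m → Fin n → ℕ) →
  c * ∑[ i < m ] ∑[ j < n ] f i j ≡ ∑[ i < m ] ∑[ j < n ] (c * f i j)
*-distribˡ-∑∑ {n = n} c f = trans (*-distribˡ-sum c (λ i → ∑[ j < n ] f i j)) (sum-cong-≗ (λ i → *-distribˡ-sum c (f i)))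

-- Charges are kept subtraction-free: c * e + w ≤ c′ * s + d stands for c′ s − c e ≥ w − d.
sum-charge : ∀ {n} c c′ (e w s d : Fin n → ℕ) → (∀ i → c * e i + w i ≤ c′ * s i + d i) →
  c * sum e + sum w ≤ c′ * sum s + sum d
sum-charge c c′ e w s d h = subst₂ _≤_ (linear c e w) (linear c′ s d) (sum-mono-≤ h)
  where
    linear : ∀ c (x y : Fin _ → ℕ) → ∑[ i < _ ] (c * x i + y i) ≡ c * sum x + sum y
    linear c x y = trans (∑-distrib-+ (λ i → c * x i) y) (cong (_+ sum y) (sym (*-distribˡ-sum c x)))

within : {V : Set} → (V → Bool) → V × V → Bool
within S e = S (proj₁ e) ∧ S (proj₂ e)

pathEdgesIn : ∀ {K} → (Fin (suc K) → Bool) → ℕ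
pathEdgesIn {K} f = count (within f) (pathEdges K)

full : ∀ {K} → (Fin (suc K) → Bool) → Bool
full {zero} f = f zero
full {suc K} f = f zero ∧ full (f ∘ suc)

pathEdgesIn-suc : ∀ {K} (f : Fin (suc (suc K)) → Bool) →
  pathEdgesIn f ≡ ⟦ f zero ∧ f (suc zero) ⟧ + pathEdgesIn (f ∘ suc)
pathEdgesIn-suc {K} f with f zero ∧ f (suc zero)
... | true = cong suc (count-map (within f) _ (pathEdges K))
... | false = count-map (within f) _ (pathEdges K)

size-full : ∀ {K} (f : Fin (suc K) → Bool) → full f ≡ true → size f ≡ suc K
size-full {zero} f eq = cong (λ b → ⟦ b ⟧ + 0) eq
size-full {suc K} f eq with f zero
... | true = cong suc (size-full (f ∘ suc) eq)

pathEdgesIn-all : ∀ {K} (f : Fin (suc K) → Bool) → (∀ t → f t ≡ true) → pathEdgesIn f ≡ K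
pathEdgesIn-all {zero} f all = refl
pathEdgesIn-all {suc K} f all = begin
  pathEdgesIn f                                   ≡⟨ pathEdgesIn-suc f ⟩
  ⟦ f zero ∧ f (suc zero) ⟧ + pathEdgesIn (f ∘ suc)
    ≡⟨ cong₂ (λ x y → ⟦ x ∧ y ⟧ + pathEdgesIn (f ∘ suc)) (all zero) (all (suc zero)) ⟩
  suc (pathEdgesIn (f ∘ suc))                      ≡⟨ cong suc (pathEdgesIn-all (f ∘ suc) (all ∘ suc)) ⟩
  suc K                                            ∎
  where open ≡-Reasoning

ends≤size : ∀ {K} (f : Fin (suc (suc K)) → Bool) → ⟦ f zero ⟧ + ⟦ f (fromℕ (suc K)) ⟧ ≤ size f
ends≤size {K} f = +-monoʳ-≤ ⟦ f zero ⟧ (entry≤sum (λ t → ⟦ f (suc t) ⟧) (fromℕ K))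

-- s vertices of a path span at most s − 1 of its edges, and at most s − 2 if they contain both ends
-- but not the whole path; a and b select which ends are charged.
path-bound : ∀ {K} (f : Fin (suc K) → Bool) a b →
  ⟦ a ∧ f zero ⟧ + ⟦ b ∧ f (fromℕ K) ⟧ + pathEdgesIn f ≤ size f + ⟦ a ∧ b ∧ full f ⟧
path-bound {zero} f a b = single a b (f zero)
  where
    single : ∀ a b x → ⟦ a ∧ x ⟧ + ⟦ b ∧ x ⟧ + 0 ≤ ⟦ x ⟧ + 0 + ⟦ a ∧ b ∧ x ⟧
    single false false x = z≤n
    single false true x = m≤m+n _ 0
    single true false x = ≤-refl
    single true true true = ≤-refl
    single true true false = ≤-refl
path-bound {suc K} f a b =
  subst (λ p → ⟦ a ∧ f zero ⟧ + ⟦ b ∧ f (fromℕ (suc K)) ⟧ + p ≤ size f + ⟦ a ∧ b ∧ full f ⟧)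
        (sym (pathEdgesIn-suc f))
    (step a b (f zero) (f (suc zero)) (full (f ∘ suc)) (path-bound (f ∘ suc) (f zero) b))
  where
    shuffle : ∀ y l p → y + l + p ≡ l + (y + p)
    shuffle = solve-∀

    step : ∀ a b x y F {l p s} → ⟦ x ∧ y ⟧ + l + p ≤ s + ⟦ x ∧ b ∧ F ⟧ →
      ⟦ a ∧ x ⟧ + l + (⟦ x ∧ y ⟧ + p) ≤ ⟦ x ⟧ + s + ⟦ a ∧ b ∧ x ∧ F ⟧
    step false b false y F ih = ih
    step true false false y F ih = ih
    step true true false y F ih = ih
    step true b true y F {l} {p} {s} ih = s≤s (subst (_≤ s + ⟦ b ∧ F ⟧) (shuffle ⟦ y ⟧ l p) ih)
    step false b true y F {l} {p} {s} ih =
      subst₂ _≤_ (shuffle ⟦ y ⟧ l p) (+-suc s 0) (≤-trans ih (+-monoʳ-≤ s (⟦⟧≤1 (b ∧ F))))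

-- Charging a single gadget

charge-≤ : ∀ c {e w t} d → e ≤ t → w ≤ t → c * e + w ≤ suc c * t + d
charge-≤ c {t = t} d e≤t w≤t =
  ≤-trans (+-mono-≤ (*-monoʳ-≤ c e≤t) w≤t) (≤-trans (≤-reflexive (+-comm (c * t) t)) (m≤m+n _ d))

m≤n+0⇒m≤n : ∀ {m n} → m ≤ n + 0 → m ≤ n
m≤n+0⇒m≤n {n = n} = subst (_ ≤_) (+-identityʳ n)

-- Edges of G[S] inside a bit graph with selection f, together with its two connectors; a and b
-- say whether the special vertices of its row and column graphs lie in S.
blockEdges : ∀ {K} (m a b : Bool) → (Fin (suc K) → Bool) → ℕ
blockEdges m a b f = ⟦ a ∧ f zero ⟧ + ⟦ b ∧ f (fromℕ _) ⟧ + (if m then pathEdgesIn f else 0)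

blockEdges≤ : ∀ {K} → 1 ≤ K → ∀ m a b (f : Fin (suc K) → Bool) →
  blockEdges m a b f ≤ size f + ⟦ a ∧ b ∧ m ∧ full f ⟧
blockEdges≤ k≥1 true a b f = path-bound f a b
blockEdges≤ {suc K} k≥1 false a b f = ≤-trans ends (m≤m+n (size f) _)
  where
    ends : ⟦ a ∧ f zero ⟧ + ⟦ b ∧ f (fromℕ (suc K)) ⟧ + 0 ≤ size f
    ends = ≤-trans (≤-reflexive (+-identityʳ _))
             (≤-trans (+-mono-≤ (⟦∧⟧≤⟦⟧ a _) (⟦∧⟧≤⟦⟧ b _)) (ends≤size f))

-- A bit graph owns at most as many edges as it has vertices in S, except when it lies wholly in S
-- together with both connectors; then it owns k + 1 edges, and c (k + 1) = (c + 1) k + 6 for c = k + 6.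
block-charge : ∀ {K} → 1 ≤ K → ∀ m a b (f : Fin (suc K) → Bool) →
  (suc K + 6) * blockEdges m a b f + ⟦ not a ⟧ * size f ≤ suc (suc K + 6) * size f + 6 * ⟦ m ∧ a ∧ b ⟧
block-charge {K} k≥1 m false b f =
  charge-≤ (suc K + 6) _ (m≤n+0⇒m≤n (blockEdges≤ k≥1 m false b f)) (≤-reflexive (+-identityʳ (size f)))
block-charge {K} k≥1 m true false f = charge-≤ (suc K + 6) _ (m≤n+0⇒m≤n (blockEdges≤ k≥1 m true false f)) z≤n
block-charge {K} k≥1 false true true f = charge-≤ (suc K + 6) _ (m≤n+0⇒m≤n (blockEdges≤ k≥1 false true true f)) z≤n
block-charge {K} k≥1 true true true f with full f in closed | blockEdges≤ k≥1 true true true f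
... | false | bound = charge-≤ (suc K + 6) _ (m≤n+0⇒m≤n bound) z≤n
... | true | bound rewrite size-full f closed = closed-block bound
  where closed-block : ∀ {e} → e ≤ suc K + 1 → (suc K + 6) * e + 0 ≤ suc (suc K + 6) * suc K + 6
        closed-block {e} e≤k+1 = begin
          (suc K + 6) * e + 0          ≡⟨ +-identityʳ _ ⟩
          (suc K + 6) * e              ≤⟨ *-monoʳ-≤ (suc K + 6) e≤k+1 ⟩
          (suc K + 6) * (suc K + 1)    ≡⟨ balance K ⟩
          suc (suc K + 6) * suc K + 6  ∎
          where open ≤-Reasoning
                balance : ∀ K → (suc K + 6) * (suc K + 1) ≡ suc (suc K + 6) * suc K + 6
                balance = solve-∀

triangle-charge : ∀ {V : Set} (S : V → Bool) (r : Fin 3 → V) u →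
  count (within S) (if u then mapE r triangle else []) + ⟦ not u ∧ S (r zero) ⟧ ≤ size (S ∘ r)
triangle-charge S r false = m≤m+n ⟦ S (r zero) ⟧ _
triangle-charge S r true with S (r zero) | S (r (suc zero)) | S (r (suc (suc zero)))
... | true  | true  | true  = ≤-refl
... | true  | true  | false = s≤s z≤n
... | true  | false | true  = s≤s z≤n
... | false | true  | true  = s≤s z≤n
... | true  | false | false = z≤n
... | false | true  | false = z≤n
... | false | false | true  = z≤n
... | false | false | false = z≤n

closed-block≤open-ends : ∀ u m v a b → ¬ T (u ∧ m ∧ v) → ⟦ m ∧ a ∧ b ⟧ ≤ ⟦ not u ∧ a ⟧ + ⟦ not v ∧ b ⟧
closed-block≤open-ends u false v a b _ = z≤n
closed-block≤open-ends u true v false b _ = z≤n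
closed-block≤open-ends u true v true false _ = z≤n
closed-block≤open-ends false true v true true _ = s≤s z≤n
closed-block≤open-ends true true false true true _ = s≤s z≤n
closed-block≤open-ends true true true true true no-cell = ⊥-elim (no-cell _)

triangle-full : ∀ {V : Set} (S : V → Bool) (r : Fin 3 → V) → (∀ x → S (r x) ≡ true) →
  count (within S) (mapE r triangle) ≡ 3
triangle-full S r all rewrite all zero | all (suc zero) | all (suc (suc zero)) = refl

blockEdges-full : ∀ {K} {m a b} (f : Fin (suc K) → Bool) → m ≡ true → a ≡ true → b ≡ true →
  (∀ t → f t ≡ true) → blockEdges m a b f ≡ 2 + K
blockEdges-full {K} f refl refl refl all rewrite all zero | all (fromℕ K) | pathEdgesIn-all f all = refl

-- Charging all of S

combine-charges : ∀ c {B W V D R ρ X C γ Y} →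
  c * B + W ≤ suc c * V + D → c * (R + ρ) + X ≤ suc c * X → c * (C + γ) + Y ≤ suc c * Y → D ≤ c * (ρ + γ) →
  c * (B + (R + C)) + (W + (X + Y)) ≤ suc c * (V + (X + Y))
combine-charges c {B} {W} {V} {D} {R} {ρ} {X} {C} {γ} {Y} blocks rows cols closed =
  +-cancelʳ-≤ (c * (ρ + γ)) _ _ (subst₂ _≤_ (regroupˡ c B W R ρ X C γ Y) (regroupʳ c V ρ γ X Y)
    (+-mono-≤ (+-mono-≤ (≤-trans blocks (+-monoʳ-≤ (suc c * V) closed)) rows) cols))
  where
    regroupˡ : ∀ c B W R ρ X C γ Y → c * B + W + (c * (R + ρ) + X) + (c * (C + γ) + Y)
                 ≡ c * (B + (R + C)) + (W + (X + Y)) + c * (ρ + γ)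
    regroupˡ = solve-∀
    regroupʳ : ∀ c V ρ γ X Y → suc c * V + c * (ρ + γ) + suc c * X + suc c * Y
                 ≡ suc c * (V + (X + Y)) + c * (ρ + γ)
    regroupʳ = solve-∀

module Census {n K : ℕ} (S : Vtx n (suc K) → Bool) where

  a b : Fin n → Bool
  a i = S (row i zero)
  b j = S (col j zero)

  block : Fin n → Fin n → Fin (suc K) → Bool
  block i j t = S (bit i j t)

  card≡ : card n K S ≡ ∑[ i < n ] ∑[ j < n ] size (block i j) + (∑[ i < n ] size (S ∘ row i) + ∑[ j < n ] size (S ∘ col j))
  card≡ = trans (count-++ S blockVs _) (cong₂ _+_ blocks (trans (count-++ S rowVs _) (cong₂ _+_ rows cols)))
    where
      blockVs rowVs : List (Vtx n (suc K))
      blockVs = concatMap (λ i → concatMap (λ j → map (bit i j) (allFin (suc K))) (allFin n)) (allFin n)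
      rowVs = concatMap (λ i → map (row i) (allFin 3)) (allFin n)
      blocks : count S blockVs ≡ ∑[ i < n ] ∑[ j < n ] size (block i j)
      blocks = trans (count-concatMap-tabulate S (λ i → concatMap (λ j → map (bit i j) (allFin (suc K))) (allFin n)) (λ i → i))
        (sum-cong-≗ λ i → trans (count-concatMap-tabulate S (λ j → map (bit i j) (allFin (suc K))) (λ j → j))
          (sum-cong-≗ λ j → count-map-allFin S (bit i j)))
      rows : count S rowVs ≡ ∑[ i < n ] size (S ∘ row i)
      rows = trans (count-concatMap-tabulate S (λ i → map (row i) (allFin 3)) (λ i → i))
        (sum-cong-≗ λ i → count-map-allFin S (row i))
      cols : count S (concatMap (λ j → map (col j) (allFin 3)) (allFin n)) ≡ ∑[ j < n ] size (S ∘ col j)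
      cols = trans (count-concatMap-tabulate S (λ j → map (col j) (allFin 3)) (λ j → j))
        (sum-cong-≗ λ j → count-map-allFin S (col j))

  slack : ℕ
  slack = ∑[ i < n ] ∑[ j < n ] (⟦ not (a i) ⟧ * size (block i j))
            + (∑[ i < n ] size (S ∘ row i) + ∑[ j < n ] size (S ∘ col j))

  -- If no row or column vertex lies in S, every block counts fully in the slack.
  slack-positive : 0 < card n K S → 0 < slack
  slack-positive 0<card with ∑[ i < n ] size (S ∘ row i) + ∑[ j < n ] size (S ∘ col j) in noGadgets
  ... | suc m = ≤-trans (s≤s z≤n) (m≤n+m (suc m) _)
  ... | zero = subst (0 <_) (trans card≡ (cong₂ _+_ (sym (sum-cong-≗ λ i → sum-cong-≗ (unselected i))) noGadgets)) 0<card
    where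
      a≤0 : ∀ i → ⟦ a i ⟧ ≤ 0
      a≤0 i = ≤-trans (m≤m+n ⟦ a i ⟧ _) (≤-trans (entry≤sum (λ x → size (S ∘ row x)) i)
                (≤-trans (m≤m+n _ _) (≤-reflexive noGadgets)))
      unselected : ∀ i j → ⟦ not (a i) ⟧ * size (block i j) ≡ size (block i j)
      unselected i j with a i | a≤0 i
      ... | false | _ = +-identityʳ _
      ... | true | ()

  module _ (M : Fin n → Fin n → Bool) (u v : Fin n → Bool) where

    triangleEdges : Bool → (Fin 3 → Vtx n (suc K)) → ℕ
    triangleEdges x r = count (within S) (if x then mapE r triangle else [])

    edgesIn≡ : edgesIn n K M u v S ≡
      ∑[ i < n ] ∑[ j < n ] blockEdges (M i j) (a i) (b j) (block i j)
        + (∑[ i < n ] triangleEdges (u i) (row i) + ∑[ j < n ] triangleEdges (v j) (col j))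
    edgesIn≡ = begin
      edgesIn n K M u v S
        ≡⟨ count-++ P pathEs _ ⟩
      count P pathEs + count P (rowEs ++ colEs ++ rowLinkEs ++ colLinkEs)
        ≡⟨ cong₂ _+_ paths (trans (count-++ P rowEs _) (cong₂ _+_ rowTriangles (trans (count-++ P colEs _) (cong₂ _+_ colTriangles
             (trans (count-++ P rowLinkEs _) (cong₂ _+_ rowLinks colLinks)))))) ⟩
      ∑∑ pathTerm + (R + (C + (∑∑ rowLink + ∑∑ colLink)))
        ≡⟨ regroup (∑∑ pathTerm) R C (∑∑ rowLink) (∑∑ colLink) ⟩
      ∑∑ rowLink + ∑∑ colLink + ∑∑ pathTerm + (R + C)
        ≡⟨ cong (_+ (R + C)) (sym (trans (∑∑-distrib-+ _ pathTerm)
                                         (cong (_+ ∑∑ pathTerm) (∑∑-distrib-+ rowLink colLink)))) ⟩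
      ∑∑ (λ i j → blockEdges (M i j) (a i) (b j) (block i j)) + (R + C)
        ∎
      where
        open ≡-Reasoning
        P = within S
        Edge = Vtx n (suc K) × Vtx n (suc K)
        pathEs rowEs colEs rowLinkEs colLinkEs : List Edge
        pathsOf : Fin n → Fin n → List Edge
        pathsOf i j = if M i j then mapE (bit i j) (pathEdges K) else []
        pathEs = concatMap (λ i → concatMap (pathsOf i) (allFin n)) (allFin n)
        rowEs = concatMap (λ i → if u i then mapE (row i) triangle else []) (allFin n)
        colEs = concatMap (λ j → if v j then mapE (col j) triangle else []) (allFin n)
        rowLinkEs = concatMap (λ i → map (λ j → row i zero , bit i j zero) (allFin n)) (allFin n)
        colLinkEs = concatMap (λ i → map (λ j → col j zero , bit i j (fromℕ K)) (allFin n)) (allFin n)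
        ∑∑ : (Fin n → Fin n → ℕ) → ℕ
        ∑∑ f = ∑[ i < n ] ∑[ j < n ] f i j
        R = ∑[ i < n ] triangleEdges (u i) (row i)
        C = ∑[ j < n ] triangleEdges (v j) (col j)
        pathTerm rowLink colLink : Fin n → Fin n → ℕ
        pathTerm i j = if M i j then pathEdgesIn (block i j) else 0
        rowLink i j = ⟦ a i ∧ block i j zero ⟧
        colLink i j = ⟦ b j ∧ block i j (fromℕ K) ⟧
        paths : count P pathEs ≡ ∑∑ pathTerm
        paths = trans (count-concatMap-tabulate P (λ i → concatMap (pathsOf i) (allFin n)) (λ i → i)) (sum-cong-≗ λ i →
                  trans (count-concatMap-tabulate P (pathsOf i) (λ j → j)) (sum-cong-≗ λ j →
                    trans (count-if P (M i j) _) (cong (λ x → if M i j then x else 0) (count-map P _ (pathEdges K)))))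
        rowTriangles : count P rowEs ≡ R
        rowTriangles = count-concatMap-tabulate P (λ i → if u i then mapE (row i) triangle else []) (λ i → i)
        colTriangles : count P colEs ≡ C
        colTriangles = count-concatMap-tabulate P (λ j → if v j then mapE (col j) triangle else []) (λ j → j)
        rowLinks : count P rowLinkEs ≡ ∑∑ rowLink
        rowLinks = trans (count-concatMap-tabulate P (λ i → map (λ j → row i zero , bit i j zero) (allFin n)) (λ i → i))
          (sum-cong-≗ λ i → count-map-allFin P (λ j → row i zero , bit i j zero))
        colLinks : count P colLinkEs ≡ ∑∑ colLink
        colLinks = trans (count-concatMap-tabulate P (λ i → map (λ j → col j zero , bit i j (fromℕ K)) (allFin n)) (λ i → i))
          (sum-cong-≗ λ i → count-map-allFin P (λ j → col j zero , bit i j (fromℕ K)))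
        regroup : ∀ p r c x y → p + (r + (c + (x + y))) ≡ x + y + p + (r + c)
        regroup = solve-∀

    rowOpen colOpen : Fin n → ℕ
    rowOpen i = ⟦ not (u i) ∧ a i ⟧
    colOpen j = ⟦ not (v j) ∧ b j ⟧

    triangles-charge : ∀ c (x : Fin n → Bool) (r : Fin n → Fin 3 → Vtx n (suc K)) →
      c * (∑[ i < n ] triangleEdges (x i) (r i) + ∑[ i < n ] ⟦ not (x i) ∧ S (r i zero) ⟧) + ∑[ i < n ] size (S ∘ r i)
        ≤ suc c * ∑[ i < n ] size (S ∘ r i)
    triangles-charge c x r = subst₂ _≤_
      (cong (λ e → c * e + ∑[ i < n ] size (S ∘ r i)) (∑-distrib-+ spanned exposed))
      (trans (cong (suc c * ∑[ i < n ] size (S ∘ r i) +_) (sum-replicate-zero n)) (+-identityʳ _))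
      (sum-charge c (suc c) (λ i → spanned i + exposed i) sizes sizes (λ _ → 0)
        (λ i → charge-≤ c 0 (triangle-charge S (r i) (x i)) ≤-refl))
      where
        spanned exposed sizes : Fin n → ℕ
        spanned i = triangleEdges (x i) (r i)
        exposed i = ⟦ not (x i) ∧ S (r i zero) ⟧
        sizes i = size (S ∘ r i)

    blocks-charge : 1 ≤ K →
      (suc K + 6) * ∑[ i < n ] ∑[ j < n ] blockEdges (M i j) (a i) (b j) (block i j)
        + ∑[ i < n ] ∑[ j < n ] (⟦ not (a i) ⟧ * size (block i j))
      ≤ suc (suc K + 6) * ∑[ i < n ] ∑[ j < n ] size (block i j) + ∑[ i < n ] ∑[ j < n ] (6 * ⟦ M i j ∧ a i ∧ b j ⟧)
    blocks-charge k≥1 = sum-charge c (suc c) (∑ˢ spanned) (∑ˢ exposed) (∑ˢ sizes) (∑ˢ closed) λ i →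
      sum-charge c (suc c) (spanned i) (exposed i) (sizes i) (closed i) λ j → block-charge k≥1 (M i j) (a i) (b j) (block i j)
      where
        c = suc K + 6
        spanned exposed sizes closed : Fin n → Fin n → ℕ
        spanned i j = blockEdges (M i j) (a i) (b j) (block i j)
        exposed i j = ⟦ not (a i) ⟧ * size (block i j)
        sizes i j = size (block i j)
        closed i j = 6 * ⟦ M i j ∧ a i ∧ b j ⟧
        ∑ˢ : (Fin n → Fin n → ℕ) → Fin n → ℕ
        ∑ˢ f i = sum (f i)

    closed-blocks≤ : (∀ i j → ¬ T (u i ∧ M i j ∧ v j)) → ∀ c → 6 * n ≤ c →
      ∑[ i < n ] ∑[ j < n ] (6 * ⟦ M i j ∧ a i ∧ b j ⟧) ≤ c * (sum rowOpen + sum colOpen)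
    closed-blocks≤ no-cell c 6n≤c = begin
      ∑[ i < n ] ∑[ j < n ] (6 * ⟦ M i j ∧ a i ∧ b j ⟧)
        ≤⟨ sum-mono-≤ (λ i → sum-mono-≤ λ j →
             *-monoʳ-≤ 6 (closed-block≤open-ends (u i) (M i j) (v j) (a i) (b j) (no-cell i j))) ⟩
      ∑[ i < n ] ∑[ j < n ] (6 * (rowOpen i + colOpen j)) ≡⟨ sym (*-distribˡ-∑∑ 6 (λ i j → rowOpen i + colOpen j)) ⟩
      6 * ∑[ i < n ] ∑[ j < n ] (rowOpen i + colOpen j)   ≡⟨ cong (6 *_) (∑∑-separable rowOpen colOpen) ⟩
      6 * (n * sum rowOpen + n * sum colOpen)            ≡⟨ factor 6 n (sum rowOpen) (sum colOpen) ⟩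
      6 * n * (sum rowOpen + sum colOpen)                ≤⟨ *-monoˡ-≤ _ 6n≤c ⟩
      c * (sum rowOpen + sum colOpen)                    ∎
      where open ≤-Reasoning
            factor : ∀ c n x y → c * (n * x + n * y) ≡ c * n * (x + y)
            factor = solve-∀

    sparse-bound : 1 ≤ K → 6 * n ≤ suc K + 6 → (∀ i j → ¬ T (u i ∧ M i j ∧ v j)) →
      (suc K + 6) * edgesIn n K M u v S + slack ≤ suc (suc K + 6) * card n K S
    sparse-bound k≥1 6n≤c no-cell = begin
      c * edgesIn n K M u v S + slack      ≡⟨ cong (λ E → c * E + slack) edgesIn≡ ⟩
      c * (B + (R + C)) + (W + (Rs + Cs))
        ≤⟨ combine-charges c {B} {W} {V} {D} {R} {sum rowOpen} {Rs} {C} {sum colOpen} {Cs} blocks rows cols closed ⟩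
      suc c * (V + (Rs + Cs))                ≡⟨ cong (suc c *_) (sym card≡) ⟩
      suc c * card n K S                   ∎
      where
        open ≤-Reasoning
        c B R C W Rs Cs V D : ℕ
        c = suc K + 6
        B = ∑[ i < n ] ∑[ j < n ] blockEdges (M i j) (a i) (b j) (block i j)
        R = ∑[ i < n ] triangleEdges (u i) (row i)
        C = ∑[ j < n ] triangleEdges (v j) (col j)
        W = ∑[ i < n ] ∑[ j < n ] (⟦ not (a i) ⟧ * size (block i j))
        Rs = ∑[ i < n ] size (S ∘ row i)
        Cs = ∑[ j < n ] size (S ∘ col j)
        V = ∑[ i < n ] ∑[ j < n ] size (block i j)
        D = ∑[ i < n ] ∑[ j < n ] (6 * ⟦ M i j ∧ a i ∧ b j ⟧)
        blocks : c * B + W ≤ suc c * V + D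
        blocks = blocks-charge k≥1
        rows : c * (R + sum rowOpen) + Rs ≤ suc c * Rs
        rows = triangles-charge c u row
        cols : c * (C + sum colOpen) + Cs ≤ suc c * Cs
        cols = triangles-charge c v col
        closed : D ≤ c * (sum rowOpen + sum colOpen)
        closed = closed-blocks≤ no-cell c 6n≤c

    triangleEdges-full : ∀ {x} r → x ≡ true → (∀ y → S (r y) ≡ true) → triangleEdges x r ≡ 3
    triangleEdges-full r refl = triangle-full S r

    cell-edges : ∀ i j → u i ≡ true → M i j ≡ true → v j ≡ true →
      (∀ t → S (bit i j t) ≡ true) → (∀ x → S (row i x) ≡ true) → (∀ y → S (col j y) ≡ true) →
      suc K + 7 ≤ edgesIn n K M u v S
    cell-edges i j ui Mij vj inB inR inC = begin
      suc K + 7                        ≡⟨ cong suc (+-suc K 6) ⟩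
      2 + K + (3 + 3)                  ≡⟨ sym (cong₂ _+_ (blockEdges-full (block i j) Mij (inR zero) (inC zero) inB)
                                            (cong₂ _+_ (triangleEdges-full (row i) ui inR) (triangleEdges-full (col j) vj inC))) ⟩
      blockEdges (M i j) (a i) (b j) (block i j) + (triangleEdges (u i) (row i) + triangleEdges (v j) (col j))
        ≤⟨ +-mono-≤ (entry≤∑∑ (λ x y → blockEdges (M x y) (a x) (b y) (block x y)) i j)
                    (+-mono-≤ (entry≤sum (λ x → triangleEdges (u x) (row x)) i)
                              (entry≤sum (λ y → triangleEdges (v y) (col y)) j)) ⟩
      ∑[ x < n ] ∑[ y < n ] blockEdges (M x y) (a x) (b y) (block x y)
        + (∑[ x < n ] triangleEdges (u x) (row x) + ∑[ y < n ] triangleEdges (v y) (col y))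
        ≡⟨ sym edgesIn≡ ⟩
      edgesIn n K M u v S              ∎
      where open ≤-Reasoning

    sparse : 1 ≤ K → 6 * n ≤ suc K + 6 → (∀ i j → ¬ T (u i ∧ M i j ∧ v j)) → 0 < card n K S →
      (suc K + 6) * edgesIn n K M u v S < (suc K + 7) * card n K S
    sparse k≥1 6n≤c no-cell 0<card = begin-strict
      (suc K + 6) * edgesIn n K M u v S          <⟨ m<m+n _ (slack-positive 0<card) ⟩
      (suc K + 6) * edgesIn n K M u v S + slack  ≤⟨ sparse-bound k≥1 6n≤c no-cell ⟩
      suc (suc K + 6) * card n K S               ≡⟨ cong (_* card n K S) (sym (+-suc (suc K) 6)) ⟩
      (suc K + 7) * card n K S                   ∎
      where open ≤-Reasoning

-- The dense set

Dense : ∀ n K → (Fin n → Fin n → Bool) → (u v : Fin n → Bool) → (Vtx n (suc K) → Bool) → Set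
Dense n K M u v S = (0 < card n K S) × ((suc K + 7) * card n K S ≤ (suc K + 6) * edgesIn n K M u v S)

cell : ∀ {n K} → Fin n → Fin n → Vtx n (suc K) → Bool
cell i j (bit x y _) = does (x ≟ i) ∧ does (y ≟ j)
cell i j (row x _) = does (x ≟ i)
cell i j (col y _) = does (y ≟ j)

card-cell : ∀ {n K} (i j : Fin n) → card n K (cell i j) ≡ suc K + 6
card-cell {n} {K} i j = trans card≡ (cong₂ _+_ blocks (cong₂ _+_ (triangles i) (triangles j)))
  where
    open Census (cell {n} {K} i j) using (card≡; block)
    scaled : ∀ p q → suc K * ⟦ p ∧ q ⟧ ≡ (if p then (if q then suc K else 0) else 0)
    scaled true true = *-identityʳ (suc K)
    scaled true false = *-zeroʳ (suc K)
    scaled false q = *-zeroʳ (suc K)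
    inner : ∀ p → ∑[ y < n ] (if p then (if does (y ≟ j) then suc K else 0) else 0) ≡ (if p then suc K else 0)
    inner true = sum-δ j (suc K)
    inner false = sum-replicate-zero n
    blocks : ∑[ x < n ] ∑[ y < n ] size (block x y) ≡ suc K
    blocks = trans (sum-cong-≗ λ x →
               trans (sum-cong-≗ λ y → trans (sum-const (suc K) _) (scaled (does (x ≟ i)) (does (y ≟ j))))
                     (inner (does (x ≟ i))))
             (sum-δ i (suc K))
    triple : ∀ p → ⟦ p ⟧ + (⟦ p ⟧ + (⟦ p ⟧ + 0)) ≡ (if p then 3 else 0)
    triple true = refl
    triple false = refl
    triangles : ∀ k → ∑[ x < n ] (⟦ does (x ≟ k) ⟧ + (⟦ does (x ≟ k) ⟧ + (⟦ does (x ≟ k) ⟧ + 0))) ≡ 3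
    triangles k = trans (sum-cong-≗ λ x → triple (does (x ≟ k))) (sum-δ k 3)

cell-dense : ∀ {n K} M (u v : Fin n → Bool) i j → u i ≡ true → M i j ≡ true → v j ≡ true →
  Σ (Vtx n (suc K) → Bool) (Dense n K M u v)
cell-dense {n} {K} M u v i j ui Mij vj = cell i j , subst (0 <_) (sym (card-cell i j)) (s≤s z≤n) ,
  subst (λ s → (suc K + 7) * s ≤ (suc K + 6) * edgesIn n K M u v (cell i j)) (sym (card-cell i j))
    (≤-trans (≤-reflexive (*-comm (suc K + 7) (suc K + 6))) (*-monoʳ-≤ (suc K + 6) spanned))
  where
    selected : does (i ≟ i) ≡ true × does (j ≟ j) ≡ true
    selected = dec-true (i ≟ i) refl , dec-true (j ≟ j) refl
    spanned : suc K + 7 ≤ edgesIn n K M u v (cell i j)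
    spanned = Census.cell-edges (cell i j) M u v i j ui Mij vj
      (λ _ → cong₂ _∧_ (proj₁ selected) (proj₂ selected)) (λ _ → proj₁ selected) (λ _ → proj₂ selected)

T-bilin : ∀ {n} u M v → T (bilin n u M v) ⇔ ∃₂ (λ i j → T (u i ∧ M i j ∧ v j))
T-bilin {n} u M v = mk⇔ elim intro
  where
    elim : T (bilin n u M v) → ∃₂ (λ i j → T (u i ∧ M i j ∧ v j))
    elim t with satisfied (any⁻ _ (allFin n) t)
    ... | i , tᵢ with satisfied (any⁻ _ (allFin n) tᵢ)
    ... | j , tᵢⱼ = i , j , tᵢⱼ
    intro : ∃₂ (λ i j → T (u i ∧ M i j ∧ v j)) → T (bilin n u M v)
    intro (i , j , t) = any⁺ _ (lose (∈-allFin i) (any⁺ _ (lose (∈-allFin j) t)))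

T-∧³ : ∀ {x y z} → T (x ∧ y ∧ z) → x ≡ true × y ≡ true × z ≡ true
T-∧³ {true} {true} {true} _ = refl , refl , refl

theorem3p24 : (n K : ℕ) → 1 ≤ n → suc K ≡ 6 * n →
    (M : Fin n → Fin n → Bool) → (u v : Fin n → Bool) →
    (Σ (Vtx n (suc K) → Bool) (λ S → (0 < card n K S) ×
        ((suc K + 7) * card n K S ≤ (suc K + 6) * edgesIn n K M u v S)))
    ⇔ (bilin n u M v ≡ true)
theorem3p24 n K n≥1 k≡6n M u v = mk⇔ dense⇒bilin bilin⇒dense
  where
    k≥1 : 1 ≤ K
    k≥1 = s≤s⁻¹ (≤-trans (s≤s (s≤s z≤n)) (subst (6 ≤_) (sym k≡6n) (*-monoʳ-≤ 6 n≥1)))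
    6n≤k+6 : 6 * n ≤ suc K + 6
    6n≤k+6 = subst (_≤ suc K + 6) k≡6n (m≤m+n (suc K) 6)
    dense⇒bilin : Σ (Vtx n (suc K) → Bool) (Dense n K M u v) → bilin n u M v ≡ true
    dense⇒bilin (S , 0<card , dense) = Equivalence.to T-≡ (decidable-stable (T? _) λ ¬bilin →
      <⇒≱ (Census.sparse S M u v k≥1 6n≤k+6 (λ i j t → ¬bilin (Equivalence.from (T-bilin u M v) (i , j , t))) 0<card) dense)
    bilin⇒dense : bilin n u M v ≡ true → Σ (Vtx n (suc K) → Bool) (Dense n K M u v)
    bilin⇒dense eq with Equivalence.to (T-bilin u M v) (Equivalence.from T-≡ eq)
    ... | i , j , t with T-∧³ t
    ... | ui , Mij , vj = cell-dense M u v i j ui Mij vj
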